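{- Let $X$ be an $r$-regular graph. If $X$ has an efficient $(1,k)$-dominating function for some integer $k$ with $1\leq k\leq r$, then $-1$ is an eigenvalue of (the adjacency matrix of) $X$.
   Context: For a graph $X$ and vertex $v$, $N[v]$ denotes the closed neighbourhood of $v$, and for $f:V(X)\to\mathbb{R}$ and $S\subseteq V(X)$, $f(S)=\sum_{u\in S}f(u)$. For nonnegative integers $j,k$, a $(j,k)$-dominating function on $X$ is a function $f:V(X)\to\{0,1,\ldots,j\}$ with $f(N[v])\geq k$ for every vertex $v$; it is efficient if $f(N[v])=k$ for every vertex $v$. -}

module Defs where

open import Data.Nat using (ℕ; zero; suc; _+_; _≤_)
open import Data.Integer as ℤ using (ℤ; +_)
open import Data.Fin using (Fin; zero; suc; _≟_)
open import Data.Bool using (Bool; true; false; if_then_else_; _∨_)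
open import Data.Product using (Σ; ∃; _×_)
open import Relation.Nullary using (¬_)
open import Relation.Nullary.Decidable using (isYes)
open import Relation.Binary.PropositionalEquality using (_≡_)

∑ℕ : ∀ {n} → (Fin n → ℕ) → ℕ
∑ℕ {zero}  f = 0
∑ℕ {suc n} f = f zero + ∑ℕ {n} (λ i → f (suc i))

∑ℤ : ∀ {n} → (Fin n → ℤ) → ℤ
∑ℤ {zero}  f = + 0
∑ℤ {suc n} f = f zero ℤ.+ ∑ℤ {n} (λ i → f (suc i))

record Graph (n : ℕ) : Set where
  field
    Adj    : Fin n → Fin n → Bool
    sym    : ∀ u v → Adj u v ≡ Adj v u
    irrefl : ∀ v → Adj v v ≡ false
open Graph public

degree : ∀ {n} → Graph n → Fin n → ℕ
degree X v = ∑ℕ (λ u → if Adj X v u then 1 else 0)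

Regular : ∀ {n} → ℕ → Graph n → Set
Regular r X = ∀ v → degree X v ≡ r

inClosedNbhd : ∀ {n} → Graph n → Fin n → Fin n → Bool
inClosedNbhd X v u = isYes (u ≟ v) ∨ Adj X v u

closedNbhdSum : ∀ {n} → Graph n → (Fin n → ℕ) → Fin n → ℕ
closedNbhdSum X f v = ∑ℕ (λ u → if inClosedNbhd X v u then f u else 0)

IsDominating : ∀ {n} → (j k : ℕ) → Graph n → (Fin n → ℕ) → Set
IsDominating j k X f = (∀ u → f u ≤ j) × (∀ v → k ≤ closedNbhdSum X f v)

IsEfficientDominating : ∀ {n} → (j k : ℕ) → Graph n → (Fin n → ℕ) → Set
IsEfficientDominating j k X f = (∀ u → f u ≤ j) × (∀ v → closedNbhdSum X f v ≡ k)

adjMatrix : ∀ {n} → Graph n → Fin n → Fin n → ℤ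
adjMatrix X u v = if Adj X u v then + 1 else + 0

IsEigenvalue : ∀ {n} → (Fin n → Fin n → ℤ) → ℤ → Set
IsEigenvalue {n} A λ′ =
  Σ (Fin n → ℤ) λ x → (∃ λ i → ¬ (x i ≡ + 0)) ×
                       (∀ i → ∑ℤ (λ j → A i j ℤ.* x j) ≡ λ′ ℤ.* x i)

-- Let A be the adjacency matrix, 1 the all-ones vector and f the efficient
-- dominating function. Efficiency says (A + I) f = k·1 and regularity says
-- A 1 = r·1, so x = (r + 1) f − k·1 satisfies A x = (r + 1)(k·1 − f) − k r·1 = −x.
-- As f takes values in {0, 1}, every entry of x is −k or r + 1 − k, and
-- 1 ≤ k ≤ r makes both nonzero.
module Submission where

open import Defs hiding (sym)
open import Data.Nat using (ℕ; _≤_; NonZero)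
open import Data.Integer using (-[1+_])
open import Data.Fin using (Fin)
open import Data.Product using (Σ)

open import Data.Nat as ℕ using (zero; suc; z≤n; s≤s)
import Data.Nat.Properties as ℕ
open import Data.Integer using (ℤ; +_; -1ℤ; _+_; _*_; _-_; -_)
import Data.Integer.Properties as ℤ
open import Data.Integer.Tactic.RingSolver using (solve-∀)
open import Algebra.Properties.CommutativeSemigroup ℕ.+-commutativeSemigroup
  using (interchange)
open import Data.Fin using (zero; suc; _≟_)
open import Data.Bool using (true; false; if_then_else_)
open import Data.Product using (_,_)
open import Function using (_∘_)
open import Relation.Nullary using (¬_; yes; no)
open import Relation.Nullary.Decidable using (isYes)
open import Relation.Binary.PropositionalEquality
  using (_≡_; _≢_; refl; sym; trans; cong; cong₂; subst; module ≡-Reasoning)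

∑ℕ-cong : ∀ {n} {f g : Fin n → ℕ} → (∀ i → f i ≡ g i) → ∑ℕ f ≡ ∑ℕ g
∑ℕ-cong {zero}  f≗g = refl
∑ℕ-cong {suc n} f≗g = cong₂ ℕ._+_ (f≗g zero) (∑ℕ-cong (f≗g ∘ suc))

∑ℤ-cong : ∀ {n} {f g : Fin n → ℤ} → (∀ i → f i ≡ g i) → ∑ℤ f ≡ ∑ℤ g
∑ℤ-cong {zero}  f≗g = refl
∑ℤ-cong {suc n} f≗g = cong₂ _+_ (f≗g zero) (∑ℤ-cong (f≗g ∘ suc))

∑ℕ-zero : ∀ n → ∑ℕ {n} (λ _ → 0) ≡ 0
∑ℕ-zero zero    = refl
∑ℕ-zero (suc n) = ∑ℕ-zero n

∑ℕ-+ : ∀ {n} (f g : Fin n → ℕ) → ∑ℕ (λ i → f i ℕ.+ g i) ≡ ∑ℕ f ℕ.+ ∑ℕ g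
∑ℕ-+ {zero}  f g = refl
∑ℕ-+ {suc n} f g =
  trans (cong (f zero ℕ.+ g zero ℕ.+_) (∑ℕ-+ (f ∘ suc) (g ∘ suc)))
        (interchange (f zero) (g zero) (∑ℕ (f ∘ suc)) (∑ℕ (g ∘ suc)))

∑ℕ-indicator : ∀ {n} (f : Fin n → ℕ) (v : Fin n) →
               ∑ℕ (λ u → if isYes (u ≟ v) then f u else 0) ≡ f v
∑ℕ-indicator {suc n} f zero    = trans (cong (f zero ℕ.+_) (∑ℕ-zero n)) (ℕ.+-identityʳ (f zero))
∑ℕ-indicator {suc n} f (suc v) = trans (∑ℕ-cong shift) (∑ℕ-indicator (f ∘ suc) v)
  where
  shift : ∀ i → (if isYes (suc i ≟ suc v) then f (suc i) else 0)
              ≡ (if isYes (i ≟ v) then f (suc i) else 0)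
  shift i with i ≟ v
  ... | yes _ = refl
  ... | no  _ = refl

∑ℤ-pos : ∀ {n} (h : Fin n → ℕ) → ∑ℤ (+_ ∘ h) ≡ + ∑ℕ h
∑ℤ-pos {zero}  h = refl
∑ℤ-pos {suc n} h = cong (_+_ (+ h zero)) (∑ℤ-pos (h ∘ suc))

∑ℤ-linear : ∀ {n} (a b : ℤ) (g h : Fin n → ℤ) →
            ∑ℤ (λ j → a * g j + b * h j) ≡ a * ∑ℤ g + b * ∑ℤ h
∑ℤ-linear {zero}  a b g h = sym (cong₂ _+_ (ℤ.*-zeroʳ a) (ℤ.*-zeroʳ b))
∑ℤ-linear {suc n} a b g h =
  trans (cong (_+_ (a * g zero + b * h zero)) (∑ℤ-linear a b (g ∘ suc) (h ∘ suc)))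
        (regroup a b (g zero) (h zero) (∑ℤ (g ∘ suc)) (∑ℤ (h ∘ suc)))
  where
  regroup : ∀ a b p q s t → a * p + b * q + (a * s + b * t) ≡ a * (p + s) + b * (q + t)
  regroup = solve-∀

infixl 7 _·_

_·_ : ∀ {n} → (Fin n → Fin n → ℤ) → (Fin n → ℤ) → Fin n → ℤ
(A · x) i = ∑ℤ (λ j → A i j * x j)

·-linear : ∀ {n} (A : Fin n → Fin n → ℤ) (a b : ℤ) (x y : Fin n → ℤ) (i : Fin n) →
           (A · (λ j → a * x j + b * y j)) i ≡ a * (A · x) i + b * (A · y) i
·-linear A a b x y i =
  trans (∑ℤ-cong (λ j → distrib a b (A i j) (x j) (y j)))
        (∑ℤ-linear a b (λ j → A i j * x j) (λ j → A i j * y j))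
  where
  distrib : ∀ a b c p q → c * (a * p + b * q) ≡ a * (c * p) + b * (c * q)
  distrib = solve-∀

·-eigenvector-−1 : ∀ {n} (A : Fin n → Fin n → ℤ) (r k : ℤ) (f : Fin n → ℤ) →
                   (∀ i → f i + (A · f) i ≡ k) → (∀ i → (A · (λ _ → + 1)) i ≡ r) →
                   ∀ i → (A · (λ j → (+ 1 + r) * f j - k)) i
                       ≡ -1ℤ * ((+ 1 + r) * f i - k)
·-eigenvector-−1 A r k f closed ones i = begin
  (A · (λ j → s * f j - k)) i
    ≡⟨ ∑ℤ-cong (λ j → cong (A i j *_) (sub-as-scaled-one s (f j) k)) ⟩
  (A · (λ j → s * f j + - k * + 1)) i
    ≡⟨ ·-linear A s (- k) f (λ _ → + 1) i ⟩
  s * (A · f) i + - k * (A · (λ _ → + 1)) i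
    ≡⟨ cong (λ t → s * (A · f) i + - k * t) (ones i) ⟩
  s * (A · f) i + - k * r
    ≡⟨ eliminate-k (f i) ((A · f) i) k (closed i) ⟩
  -1ℤ * (s * f i - k) ∎
  where
  open ≡-Reasoning
  s : ℤ
  s = + 1 + r
  sub-as-scaled-one : ∀ s p k → s * p - k ≡ s * p + - k * + 1
  sub-as-scaled-one = solve-∀
  eliminate-k : ∀ a b k → a + b ≡ k → s * b + - k * r ≡ -1ℤ * (s * a - k)
  eliminate-k a b _ refl = identity r a b
    where
    identity : ∀ r a b → (+ 1 + r) * b + - (a + b) * r ≡ -1ℤ * ((+ 1 + r) * a - (a + b))
    identity = solve-∀

nbhdSum : ∀ {n} → Graph n → (Fin n → ℕ) → Fin n → ℕ
nbhdSum X f v = ∑ℕ (λ u → if Adj X v u then f u else 0)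

closedNbhdSum≡self+nbhdSum : ∀ {n} (X : Graph n) (f : Fin n → ℕ) (v : Fin n) →
                             closedNbhdSum X f v ≡ f v ℕ.+ nbhdSum X f v
closedNbhdSum≡self+nbhdSum X f v = begin
  closedNbhdSum X f v
    ≡⟨ ∑ℕ-cong split ⟩
  ∑ℕ (λ u → (if isYes (u ≟ v) then f u else 0) ℕ.+ (if Adj X v u then f u else 0))
    ≡⟨ ∑ℕ-+ (λ u → if isYes (u ≟ v) then f u else 0) (λ u → if Adj X v u then f u else 0) ⟩
  ∑ℕ (λ u → if isYes (u ≟ v) then f u else 0) ℕ.+ nbhdSum X f v
    ≡⟨ cong (ℕ._+ nbhdSum X f v) (∑ℕ-indicator f v) ⟩
  f v ℕ.+ nbhdSum X f v ∎
  where
  open ≡-Reasoning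
  split : ∀ u → (if inClosedNbhd X v u then f u else 0)
              ≡ (if isYes (u ≟ v) then f u else 0) ℕ.+ (if Adj X v u then f u else 0)
  split u with u ≟ v
  split u | yes refl rewrite irrefl X u = sym (ℕ.+-identityʳ (f u))
  split u | no _ with Adj X v u
  ... | true  = refl
  ... | false = refl

adjMatrix-·-+ : ∀ {n} (X : Graph n) (f : Fin n → ℕ) (v : Fin n) →
                (adjMatrix X · (+_ ∘ f)) v ≡ + nbhdSum X f v
adjMatrix-·-+ X f v = trans (∑ℤ-cong entry) (∑ℤ-pos (λ u → if Adj X v u then f u else 0))
  where
  entry : ∀ u → adjMatrix X v u * + f u ≡ + (if Adj X v u then f u else 0)
  entry u with Adj X v u
  ... | true  = ℤ.*-identityˡ (+ f u)
  ... | false = refl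

[1+r]*b≢k : ∀ {r k b} → 1 ≤ k → k ≤ r → b ≤ 1 → suc r ℕ.* b ≢ k
[1+r]*b≢k {r} 1≤k _   z≤n       eq = ℕ.<⇒≢ 1≤k (trans (sym (ℕ.*-zeroʳ (suc r))) eq)
[1+r]*b≢k {r} _   k≤r (s≤s z≤n) eq =
  ℕ.1+n≰n (subst (_≤ r) (trans (sym eq) (ℕ.*-identityʳ (suc r))) k≤r)

corollary3p4 : (n : ℕ) → .{{_ : NonZero n}} → (X : Graph n) → (r : ℕ) →
    Regular r X → (k : ℕ) → 1 ≤ k → k ≤ r →
    Σ (Fin n → ℕ) (IsEfficientDominating 1 k X) →
    IsEigenvalue (adjMatrix X) -[1+ 0 ]
corollary3p4 (suc n) X r regular k 1≤k k≤r (f , f≤1 , efficient) =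
  x , (zero , x₀≢0) , ·-eigenvector-−1 (adjMatrix X) (+ r) (+ k) (+_ ∘ f) closed ones
  where
  x : Fin (suc n) → ℤ
  x j = + suc r * + f j - + k

  closed : ∀ v → + f v + (adjMatrix X · (+_ ∘ f)) v ≡ + k
  closed v = trans (cong (_+_ (+ f v)) (adjMatrix-·-+ X f v))
                   (cong +_ (trans (sym (closedNbhdSum≡self+nbhdSum X f v)) (efficient v)))

  ones : ∀ v → (adjMatrix X · (λ _ → + 1)) v ≡ + r
  ones v = trans (adjMatrix-·-+ X (λ _ → 1) v) (cong +_ (regular v))

  x₀≢0 : ¬ (x zero ≡ + 0)
  x₀≢0 x₀≡0 = [1+r]*b≢k 1≤k k≤r (f≤1 zero)
    (ℤ.+-injective (trans (ℤ.pos-* (suc r) (f zero)) (ℤ.i-j≡0⇒i≡j _ _ x₀≡0)))
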